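{- For every graph $G$ and every integer $k \geq 2$, \[\gamma_{all,k}^\infty(G) \leq \min\{ 2\,\mathfrak{T}_{k}(G),\ \mathfrak{T}_{\lfloor k/2 \rfloor} (G) \}.\]
   Context: A depth-$j$-rooted tree ($j$ a positive integer) is a rooted tree in which the eccentricity of the root (its maximum distance to any vertex) is at most $j$. A depth-$j$-rooted tree decomposition of $G$ is a partition of $V(G)$ into sets $S_1,\dots,S_\ell$ such that each induced subgraph $G[S_i]$ contains a spanning subgraph that is a depth-$j$-rooted tree; $\mathfrak{T}_j(G)$ is the minimum number of sets over all such decompositions. Graphs are finite and simple; $d(u,v)$ is graph distance and $N_k[x]=\{v: d(x,v)\le k\}$. A multiset $D$ of vertices of $G$ is a distance-$k$ dominating set if every vertex of $V(G)\setminus D$ is at distance at most $k$ from some element of $D$. Let $\mathbb{D}_{k,q}(G)$ be the set of such multisets of cardinality $q$. $D=\{v_1,\dots,v_q\}$ transforms to $D'=\{u_1,\dots,u_q\}$ if (for some indexing) $u_i\in N_k[v_i]$ for all $i$. An eternal distance-$k$ dominating family is $\mathcal{E}\subseteq\mathbb{D}_{k,q}(G)$ for some $q$ such that for every $D\in\mathcal{E}$ and every vertex $v$ there is $D'\in\mathcal{E}$ with $v\in D'$ and $D$ transforms to $D'$. $\gamma_{all,k}^\infty(G)$ is the minimum $q$ for which such a family exists. -}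

module Defs where

open import Data.Nat using (ℕ; zero; suc; _≤_)
open import Data.Fin using (Fin)
open import Data.Product using (Σ; ∃; _×_; _,_)
open import Data.Sum using (_⊎_)
open import Relation.Binary.PropositionalEquality using (_≡_)
open import Relation.Nullary using (¬_)
open import Function.Bundles using (_↔_; Inverse)
open import Level using (0ℓ) renaming (suc to lsuc)

record Graph : Set₁ where
  field
    n      : ℕ
    Adj    : Fin n → Fin n → Set
    sym    : ∀ {u v} → Adj u v → Adj v u
    irrefl : ∀ {u} → ¬ Adj u u

open Graph public

Vertex : Graph → Set
Vertex G = Fin (n G)

data Walk (G : Graph) : Vertex G → Vertex G → ℕ → Set where
  here : ∀ {u} → Walk G u u zero
  step : ∀ {u w v m} → Adj G u w → Walk G w v m → Walk G u v (suc m)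

dist≤ : (G : Graph) → Vertex G → Vertex G → ℕ → Set
dist≤ G u v k = Σ ℕ λ m → m ≤ k × Walk G u v m

iter : ∀ {A : Set} → (A → A) → ℕ → A → A
iter f zero    x = x
iter f (suc m) x = f (iter f m x)

-- G[S] (S given as a predicate) contains a spanning subgraph that is a
-- depth-j-rooted tree: given by a root r ∈ S and a parent map p such that
-- every non-root vertex of S has its parent in S and adjacent to it, and every
-- vertex of S reaches r by at most j parent steps (its depth in the tree).
record DepthRootedSpanningTree (G : Graph) (S : Vertex G → Set) (j : ℕ) : Set where
  field
    root    : Vertex G
    root∈S  : S root
    parent  : Vertex G → Vertex G
    par∈S   : ∀ v → S v → ¬ (v ≡ root) → S (parent v)
    parAdj  : ∀ v → S v → ¬ (v ≡ root) → Adj G v (parent v)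
    depth≤j : ∀ v → S v → Σ ℕ λ m → m ≤ j × iter parent m v ≡ root

record TreeDecomposition (G : Graph) (j ℓ : ℕ) : Set where
  field
    part : Vertex G → Fin ℓ
    tree : ∀ (i : Fin ℓ) → DepthRootedSpanningTree G (λ v → part v ≡ i) j

IsTreeDecompNumber : Graph → ℕ → ℕ → Set
IsTreeDecompNumber G j t =
  TreeDecomposition G j t × (∀ ℓ → TreeDecomposition G j ℓ → t ≤ ℓ)

-- Multisets of q vertices, represented as indexed q-tuples.
Multiset : Graph → ℕ → Set
Multiset G q = Fin q → Vertex G

_∈ₘ_ : ∀ {G q} → Vertex G → Multiset G q → Set
v ∈ₘ D = ∃ λ i → D i ≡ v

IsDistDominating : (G : Graph) → ℕ → ∀ {q} → Multiset G q → Set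
IsDistDominating G k D = ∀ v → _∈ₘ_ {G} v D ⊎ (∃ λ i → dist≤ G (D i) v k)

-- D transforms to D' (for some re-indexing σ of D'): D' (σ i) ∈ N_k[D i].
Transforms : (G : Graph) → ℕ → ∀ {q} → Multiset G q → Multiset G q → Set
Transforms G k {q} D D' =
  Σ (Fin q ↔ Fin q) λ σ → ∀ i → dist≤ G (D i) (D' (Inverse.to σ i)) k

record EternalFamily (G : Graph) (k q : ℕ) : Set₁ where
  field
    family    : Multiset G q → Set
    nonempty  : ∃ λ D → family D
    dominates : ∀ D → family D → IsDistDominating G k D
    eternal   : ∀ D → family D → ∀ v →
                  ∃ λ D' → family D' × _∈ₘ_ {G} v D' × Transforms G k D D'

IsEternalDomNumber : Graph → ℕ → ℕ → Set₁
IsEternalDomNumber G k g =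
  EternalFamily G k g × (∀ q → EternalFamily G k q → g ≤ q)

{-# OPTIONS --safe #-}
module Submission where

-- Guard each part of a tree decomposition separately, with guards that only ever move
-- inside their own part; a vertex attacked in part i is then answered by the guards of
-- part i alone. For a depth-⌊k/2⌋ decomposition one guard per part suffices: any two
-- vertices of a part are within 2⌊k/2⌋ ≤ k of each other through the root. For a depth-k
-- decomposition two guards per part suffice, one of them always sitting on the root:
-- the root guard moves to the attacked vertex and the other guard returns to the root.

open import Defs
open import Data.Nat using (ℕ; zero; suc; _+_; _*_; _≤_; z≤n; s≤s; _⊓_; ⌊_/2⌋)
open import Data.Nat.Properties
  using (≤-trans; +-mono-≤; +-monoʳ-≤; ⊓-glb; ⌊n/2⌋≤⌈n/2⌉; ⌊n/2⌋+⌈n/2⌉≡n; *-comm; *-identityʳ)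
open import Data.Fin using (Fin; zero; suc; _≟_; combine; remQuot)
open import Data.Fin.Properties using (remQuot-combine)
open import Data.Vec.Functional using (updateAt)
open import Data.Vec.Functional.Properties using (updateAt-updates; updateAt-minimal)
open import Data.Product using (∃; _×_; _,_; proj₁; proj₂; uncurry)
open import Data.Sum using (inj₂)
open import Function.Base using (const)
open import Function.Construct.Identity using (↔-id)
open import Relation.Nullary using (yes; no)
open import Relation.Binary.PropositionalEquality
  using (_≡_; _≢_; refl; trans; cong; subst; subst₂) renaming (sym to ≡-sym)

module _ {G : Graph} where

  Walk-snoc : ∀ {u v w m} → Walk G u v m → Adj G v w → Walk G u w (suc m)
  Walk-snoc here       e = step e here
  Walk-snoc (step e p) f = step e (Walk-snoc p f)

  Walk-reverse : ∀ {u v m} → Walk G u v m → Walk G v u m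
  Walk-reverse here       = here
  Walk-reverse (step e p) = Walk-snoc (Walk-reverse p) (Graph.sym G e)

  Walk-++ : ∀ {u v w a b} → Walk G u v a → Walk G v w b → Walk G u w (a + b)
  Walk-++ here       q = q
  Walk-++ (step e p) q = step e (Walk-++ p q)

  dist≤-refl : ∀ {u k} → dist≤ G u u k
  dist≤-refl = 0 , z≤n , here

  dist≤-sym : ∀ {u v k} → dist≤ G u v k → dist≤ G v u k
  dist≤-sym (m , m≤k , p) = m , m≤k , Walk-reverse p

  dist≤-trans : ∀ {u v w a b} → dist≤ G u v a → dist≤ G v w b → dist≤ G u w (a + b)
  dist≤-trans (m , m≤a , p) (m′ , m′≤b , q) = m + m′ , +-mono-≤ m≤a m′≤b , Walk-++ p q

  dist≤-mono : ∀ {u v a b} → a ≤ b → dist≤ G u v a → dist≤ G u v b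
  dist≤-mono a≤b (m , m≤a , p) = m , ≤-trans m≤a a≤b , p

iter-suc : ∀ {A : Set} (f : A → A) m x → iter f (suc m) x ≡ iter f m (f x)
iter-suc f zero    x = refl
iter-suc f (suc m) x = cong f (iter-suc f m x)

module _ {G : Graph} {S : Vertex G → Set} {j : ℕ} (T : DepthRootedSpanningTree G S j) where
  open DepthRootedSpanningTree T

  dist≤-root-of-iter : ∀ m v → S v → iter parent m v ≡ root → dist≤ G v root m
  dist≤-root-of-iter zero    v v∈S eq = subst (λ r → dist≤ G v r 0) eq dist≤-refl
  dist≤-root-of-iter (suc m) v v∈S eq with v ≟ root
  ... | yes refl = dist≤-refl
  ... | no v≢root with dist≤-root-of-iter m (parent v) (par∈S v v∈S v≢root)
                         (trans (≡-sym (iter-suc parent m v)) eq)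
  ...   | m′ , m′≤m , p = suc m′ , s≤s m′≤m , step (parAdj v v∈S v≢root) p

  dist≤-root : ∀ {v} → S v → dist≤ G v root j
  dist≤-root {v} v∈S with depth≤j v v∈S
  ... | m , m≤j , eq = dist≤-mono m≤j (dist≤-root-of-iter m v v∈S eq)

  dist≤-within : ∀ {u v} → S u → S v → dist≤ G u v (j + j)
  dist≤-within u∈S v∈S = dist≤-trans (dist≤-root u∈S) (dist≤-sym (dist≤-root v∈S))

record LocalEternalFamily (G : Graph) (k m : ℕ) (S : Vertex G → Set) : Set₁ where
  field
    family   : Multiset G m → Set
    nonempty : ∃ family
    eternal  : ∀ C → family C → ∀ v → S v →
               ∃ λ C′ → family C′ × _∈ₘ_ {G} v C′ × (∀ r → dist≤ G (C r) (C′ r) k)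

open LocalEternalFamily

local-dominates : ∀ {G k m S} (L : LocalEternalFamily G k m S) →
                  ∀ C → family L C → ∀ v → S v → ∃ λ r → dist≤ G (C r) v k
local-dominates {G} {k} L C C∈L v v∈S with eternal L C C∈L v v∈S
... | _ , _ , (r , C′r≡v) , moves = r , subst (λ w → dist≤ G (C r) w k) C′r≡v (moves r)

singleGuardFamily : ∀ {G S j k} → j + j ≤ k → DepthRootedSpanningTree G S j →
                    LocalEternalFamily G k 1 S
singleGuardFamily {G} {S} j+j≤k T = record
  { family   = λ C → S (C zero)
  ; nonempty = const root , root∈S
  ; eternal  = λ C C∈S v v∈S →
      const v , v∈S , (zero , refl) , λ { zero → dist≤-mono j+j≤k (dist≤-within T C∈S v∈S) }
  }
  where open DepthRootedSpanningTree T

other : Fin 2 → Fin 2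
other zero       = suc zero
other (suc zero) = zero

other-≢ : ∀ r → other r ≢ r
other-≢ zero       ()
other-≢ (suc zero) ()

guardPairFamily : ∀ {G S k} → DepthRootedSpanningTree G S k → LocalEternalFamily G k 2 S
guardPairFamily {G} {S} {k} T = record
  { family   = λ C → (∀ r → S (C r)) × ∃ λ r → C r ≡ root
  ; nonempty = const root , const root∈S , zero , refl
  ; eternal  = answer
  }
  where
  open DepthRootedSpanningTree T

  answer : ∀ C → (∀ r → S (C r)) × (∃ λ r → C r ≡ root) → ∀ v → S v →
           ∃ λ C′ → ((∀ r → S (C′ r)) × ∃ λ r → C′ r ≡ root)
                    × _∈ₘ_ {G} v C′ × (∀ r → dist≤ G (C r) (C′ r) k)
  answer C (C∈S , r , Cr≡root) v v∈S =
    C′ , (C′∈S , other r , updateAt-minimal (other r) r (const root) (other-≢ r))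
       , (r , updateAt-updates r (const root)) , moves
    where
    C′ : Multiset G 2
    C′ = updateAt (const root) r (const v)

    C′∈S : ∀ s → S (C′ s)
    C′∈S s with s ≟ r
    ... | yes refl = subst S (≡-sym (updateAt-updates r (const root))) v∈S
    ... | no s≢r   = subst S (≡-sym (updateAt-minimal s r (const root) s≢r)) root∈S

    moves : ∀ s → dist≤ G (C s) (C′ s) k
    moves s with s ≟ r
    ... | yes refl = subst₂ (λ a b → dist≤ G a b k) (≡-sym Cr≡root)
                       (≡-sym (updateAt-updates r (const root))) (dist≤-sym (dist≤-root T v∈S))
    ... | no s≢r   = subst (λ w → dist≤ G (C s) w k) (≡-sym (updateAt-minimal s r (const root) s≢r))
                       (dist≤-root T (C∈S s))

module _ {G : Graph} {k m t : ℕ} (part : Vertex G → Fin t)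
         (L : ∀ i → LocalEternalFamily G k m (λ v → part v ≡ i)) where

  flatten : (Fin t → Multiset G m) → Multiset G (t * m)
  flatten B a = uncurry B (remQuot m a)

  flatten-combine : ∀ B i r → flatten B (combine i r) ≡ B i r
  flatten-combine B i r = cong (uncurry B) (remQuot-combine i r)

  -- Membership is witnessed by the blocks rather than tested on D's restrictions, since
  -- the local families need not be closed under pointwise equality of configurations.
  Blocked : Multiset G (t * m) → Set
  Blocked D = ∃ λ B → (∀ i → family (L i) (B i)) × D ≡ flatten B

  blocked-dominates : ∀ D → Blocked D → IsDistDominating G k D
  blocked-dominates .(flatten B) (B , B∈L , refl) v
    with local-dominates (L (part v)) (B (part v)) (B∈L (part v)) v refl
  ... | r , d =
    inj₂ (combine (part v) r , subst (λ u → dist≤ G u v k) (≡-sym (flatten-combine B _ r)) d)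

  blocked-eternal : ∀ D → Blocked D → ∀ v →
                    ∃ λ D′ → Blocked D′ × _∈ₘ_ {G} v D′ × Transforms G k D D′
  blocked-eternal .(flatten B) (B , B∈L , refl) v
    with eternal (L (part v)) (B (part v)) (B∈L (part v)) v refl
  ... | C′ , C′∈L , (r , C′r≡v) , moves =
    flatten B′ , (B′ , B′∈L , refl) , (combine i r , B′-hits-v)
      , ↔-id _ , λ a → uncurry block-moves (remQuot m a)
    where
    i : Fin t
    i = part v

    B′ : Fin t → Multiset G m
    B′ = updateAt B i (const C′)

    B′i≡C′ : B′ i ≡ C′
    B′i≡C′ = updateAt-updates i B

    B′∈L : ∀ i′ → family (L i′) (B′ i′)
    B′∈L i′ with i′ ≟ i
    ... | yes refl = subst (family (L i)) (≡-sym B′i≡C′) C′∈L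
    ... | no i′≢i  = subst (family (L i′)) (≡-sym (updateAt-minimal i′ i B i′≢i)) (B∈L i′)

    B′-hits-v : flatten B′ (combine i r) ≡ v
    B′-hits-v = trans (flatten-combine B′ i r) (trans (cong (λ C → C r) B′i≡C′) C′r≡v)

    block-moves : ∀ i′ r′ → dist≤ G (B i′ r′) (B′ i′ r′) k
    block-moves i′ r′ with i′ ≟ i
    ... | yes refl = subst (λ C → dist≤ G (B i r′) (C r′) k) (≡-sym B′i≡C′) (moves r′)
    ... | no i′≢i  = subst (λ C → dist≤ G (B i′ r′) (C r′) k)
                       (≡-sym (updateAt-minimal i′ i B i′≢i)) dist≤-refl

  gluedFamily : EternalFamily G k (t * m)
  gluedFamily = record
    { family    = Blocked
    ; nonempty  = flatten B₀ , B₀ , (λ i → proj₂ (nonempty (L i))) , refl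
    ; dominates = blocked-dominates
    ; eternal   = blocked-eternal
    }
    where
    B₀ : Fin t → Multiset G m
    B₀ i = proj₁ (nonempty (L i))

eternalFamily-of-decomposition :
  ∀ {G k j m t} → (∀ {S} → DepthRootedSpanningTree G S j → LocalEternalFamily G k m S) →
  TreeDecomposition G j t → EternalFamily G k (t * m)
eternalFamily-of-decomposition local D = gluedFamily part (λ i → local (tree i))
  where open TreeDecomposition D

⌊n/2⌋+⌊n/2⌋≤n : ∀ n → ⌊ n /2⌋ + ⌊ n /2⌋ ≤ n
⌊n/2⌋+⌊n/2⌋≤n n =
  subst (⌊ n /2⌋ + ⌊ n /2⌋ ≤_) (⌊n/2⌋+⌈n/2⌉≡n n) (+-monoʳ-≤ ⌊ n /2⌋ (⌊n/2⌋≤⌈n/2⌉ n))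

corollary7 : (G : Graph) (k : ℕ) → 2 ≤ k →
    (t₁ t₂ g : ℕ) →
    IsTreeDecompNumber G k t₁ →
    IsTreeDecompNumber G ⌊ k /2⌋ t₂ →
    IsEternalDomNumber G k g →
    g ≤ (2 * t₁) ⊓ t₂
corollary7 G k _ t₁ t₂ g (D₁ , _) (D₂ , _) (_ , g-minimal) = ⊓-glb g≤2t₁ g≤t₂
  where
  g≤2t₁ : g ≤ 2 * t₁
  g≤2t₁ = subst (g ≤_) (*-comm t₁ 2)
            (g-minimal (t₁ * 2) (eternalFamily-of-decomposition guardPairFamily D₁))

  g≤t₂ : g ≤ t₂
  g≤t₂ = subst (g ≤_) (*-identityʳ t₂)
           (g-minimal (t₂ * 1)
             (eternalFamily-of-decomposition (singleGuardFamily (⌊n/2⌋+⌊n/2⌋≤n k)) D₂))
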